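{- Let $C$ be a $k$-context and $V_1,\dots,V_k$ values. Then \[ \mathcal{T}(C[V_1,\dots,V_k])=\{\bar c[\vec v^{\,1},\dots,\vec v^{\,k}]\mid c\in\mathcal{T}(C),\ \bar c\text{ a rigid of }c,\ \vec v^{\,i}=\langle v^i_1,\dots,v^i_{\deg_{\Box_i}(c)}\rangle\text{ with }[v^i_1,\dots,v^i_{\deg_{\Box_i}(c)}]\in\mathcal{T}(V_i)\text{ for each }i\}. \]
   Context: CbV $\lambda$-terms are ordinary $\lambda$-terms ($M::=x\mid\lambda x.M\mid MM$); values are variables and abstractions. A $k$-context is a $\lambda$-term possibly containing holes $\Box_1,\dots,\Box_k$, each occurring any number of times; $C[M_1,\dots,M_k]$ replaces each $\Box_i$ by $M_i$ (capture allowed). Resource values and simple terms: $v::=x\mid\lambda x.s$, $s::=s_1s_2\mid[v_1,\dots,v_n]$ ($[\cdots]$ finite multisets, "bags"). Resource $k$-contexts (mutual induction, no $\alpha$-equivalence): $c^v::=\Box_1\mid\cdots\mid\Box_k\mid x\mid\lambda x.c^s$, $c^s::=c^s_1c^s_2\mid[c^v_1,\dots,c^v_n]$; $\deg_{\Box_i}(c)$ is the number of occurrences of $\Box_i$ in $c$. Taylor expansion (on terms and contexts): $\mathcal{T}(\Box_i)=\{[\Box_i,\dots,\Box_i]\ (m\text{ copies})\mid m\in\mathbb{N}\}$, $\mathcal{T}(x)=\{[x,\dots,x]\ (m\text{ copies})\mid m\in\mathbb{N}\}$, $\mathcal{T}(\lambda x.C)=\{[\lambda x.s_1,\dots,\lambda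 x.s_m]\mid m\in\mathbb{N},s_j\in\mathcal{T}(C)\}$, $\mathcal{T}(C_1C_2)=\{s_1s_2\mid s_i\in\mathcal{T}(C_i)\}$. Rigids: built like resource contexts with lists $\langle\cdots\rangle$ instead of bags; $\mathrm{Rigid}(\Box_i)=\{\Box_i\}$, $\mathrm{Rigid}(x)=\{x\}$, $\mathrm{Rigid}(\lambda x.c_0)=\{\lambda x.\bar c_0\mid\bar c_0\in\mathrm{Rigid}(c_0)\}$, $\mathrm{Rigid}(c_0c_1)=\{\bar c_0\bar c_1\mid\bar c_i\in\mathrm{Rigid}(c_i)\}$, $\mathrm{Rigid}([c_1,\dots,c_m])=\{\langle\bar c_{\sigma(1)},\dots,\bar c_{\sigma(m)}\rangle\mid\sigma\text{ a permutation},\bar c_i\in\mathrm{Rigid}(c_i)\}$. Filling: for $\bar c$ a rigid of $c$ and lists $\vec v^{\,i}$ of resource values of length $\deg_{\Box_i}(c)$: $\Box_i[\langle\rangle,\dots,\langle v^i_1\rangle,\dots,\langle\rangle]=v^i_1$; $x[\langle\rangle,\dots,\langle\rangle]=x$; $(\lambda x.\bar c_0)[\vec v^{\,1},\dots,\vec v^{\,k}]=\lambda x.\bar c_0[\vec v^{\,1},\dots,\vec v^{\,k}]$; for $\bar c=\bar c_1\bar c_2$ ($\bar c_j$ rigid of $c_j$), split $\vec v^{\,i}=\vec w^{\,i1}\vec w^{\,i2}$ with $\vec w^{\,ij}$ of length $\deg_{\Box_i}(c_j)$ and set $\bar c[\ldots]=\bar c_1[\vec w^{\,11},\dots,\vec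 w^{\,k1}]\,\bar c_2[\vec w^{\,12},\dots,\vec w^{\,k2}]$; for $\bar c=\langle\bar c_{\sigma(1)},\dots,\bar c_{\sigma(m)}\rangle$ ($\bar c_j$ rigid of $c_j$), split $\vec v^{\,i}=\vec w^{\,i1}\cdots\vec w^{\,im}$ with $\vec w^{\,ij}$ of length $\deg_{\Box_i}(c_{\sigma(j)})$ and set $\bar c[\ldots]=[\bar c_{\sigma(1)}[\vec w^{\,11},\dots,\vec w^{\,k1}],\dots,\bar c_{\sigma(m)}[\vec w^{\,1m},\dots,\vec w^{\,km}]]$. -}

module Defs where

open import Data.Nat using (ℕ; zero; suc; _+_)
open import Data.Fin using (Fin; zero; suc)
open import Data.List using (List; []; _∷_; map; replicate)
open import Data.List.Relation.Unary.All using (All)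
open import Data.List.Relation.Binary.Pointwise using (Pointwise)
open import Data.List.Relation.Binary.Permutation.Propositional using (_↭_)
open import Data.Vec using (Vec; head; take; drop)
open import Data.Product using (Σ; _×_)
open import Relation.Binary.PropositionalEquality using (_≡_; refl; subst)

-- Variable names (no α-equivalence, capture allowed).
Var : Set
Var = ℕ

data Ctx (k : ℕ) : Set where
  hole : Fin k → Ctx k
  var  : Var → Ctx k
  lam  : Var → Ctx k → Ctx k
  app  : Ctx k → Ctx k → Ctx k

Term : Set
Term = Ctx 0

data IsValue : Term → Set where
  isVar : (x : Var) → IsValue (var x)
  isLam : (x : Var) (M : Term) → IsValue (lam x M)

-- C[M₁,…,Mₖ] (capture allowed)
plug : ∀ {k} → Ctx k → (Fin k → Term) → Term
plug (hole i)  M = M i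
plug (var x)   M = var x
plug (lam x C) M = lam x (plug C M)
plug (app C D) M = app (plug C M) (plug D M)

-- Resource k-contexts; bags are represented by lists, taken up to
-- permutation (see _≈S_ below). Resource values/simple terms = k = 0.

mutual
  data RV (k : ℕ) : Set where
    hole : Fin k → RV k
    var  : Var → RV k
    lam  : Var → RS k → RV k

  data RS (k : ℕ) : Set where
    app : RS k → RS k → RS k
    bag : List (RV k) → RS k

mutual
  data _≈V_ {k : ℕ} : RV k → RV k → Set where
    hole : ∀ i → hole i ≈V hole i
    var  : ∀ x → var x ≈V var x
    lam  : ∀ x {s t} → s ≈S t → lam x s ≈V lam x t

  data _≈S_ {k : ℕ} : RS k → RS k → Set where
    app : ∀ {s₁ s₂ t₁ t₂} → s₁ ≈S t₁ → s₂ ≈S t₂ → app s₁ s₂ ≈S app t₁ t₂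
    bag : ∀ {us ws} (vs : List (RV k)) → us ↭ vs → Pointwise _≈V_ vs ws →
          bag us ≈S bag ws

-- Taylor expansion, as a membership relation  Taylor C s  ⇔  s ∈ 𝒯(C).

data Taylor {k : ℕ} : Ctx k → RS k → Set where
  t-hole : ∀ i (m : ℕ) → Taylor (hole i) (bag (replicate m (hole i)))
  t-var  : ∀ x (m : ℕ) → Taylor (var x) (bag (replicate m (var x)))
  t-lam  : ∀ x {C} (ss : List (RS k)) → All (Taylor C) ss →
           Taylor (lam x C) (bag (map (lam x) ss))
  t-app  : ∀ {C D s t} → Taylor C s → Taylor D t → Taylor (app C D) (app s t)

δ : ∀ {k} → Fin k → Fin k → ℕ
δ zero    zero    = 1
δ zero    (suc j) = 0
δ (suc i) zero    = 0
δ (suc i) (suc j) = δ i j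

δ-refl : ∀ {k} (j : Fin k) → δ j j ≡ 1
δ-refl zero    = refl
δ-refl (suc j) = δ-refl j

mutual
  degV : ∀ {k} → Fin k → RV k → ℕ
  degV i (hole j)  = δ i j
  degV i (var x)   = 0
  degV i (lam x s) = degS i s

  degS : ∀ {k} → Fin k → RS k → ℕ
  degS i (app s t) = degS i s + degS i t
  degS i (bag vs)  = degL i vs

  degL : ∀ {k} → Fin k → List (RV k) → ℕ
  degL i []       = 0
  degL i (v ∷ vs) = degV i v + degL i vs

mutual
  data RigV (k : ℕ) : Set where
    hole : Fin k → RigV k
    var  : Var → RigV k
    lam  : Var → RigS k → RigV k

  data RigS (k : ℕ) : Set where
    app  : RigS k → RigS k → RigS k
    list : List (RigV k) → RigS k

mutual
  data RigidV {k : ℕ} : RV k → RigV k → Set where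
    hole : ∀ i → RigidV (hole i) (hole i)
    var  : ∀ x → RigidV (var x) (var x)
    lam  : ∀ x {c r} → RigidS c r → RigidV (lam x c) (lam x r)

  data RigidS {k : ℕ} : RS k → RigS k → Set where
    app  : ∀ {c₁ c₂ r₁ r₂} → RigidS c₁ r₁ → RigidS c₂ r₂ →
           RigidS (app c₁ c₂) (app r₁ r₂)
    list : ∀ {cs rs} (cσ : List (RV k)) → cs ↭ cσ → Pointwise RigidV cσ rs →
           RigidS (bag cs) (list rs)

-- Degrees of rigids (equal to those of the underlying resource context).
mutual
  rdegV : ∀ {k} → Fin k → RigV k → ℕ
  rdegV i (hole j)  = δ i j
  rdegV i (var x)   = 0
  rdegV i (lam x s) = rdegS i s

  rdegS : ∀ {k} → Fin k → RigS k → ℕ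
  rdegS i (app s t) = rdegS i s + rdegS i t
  rdegS i (list vs) = rdegL i vs

  rdegL : ∀ {k} → Fin k → List (RigV k) → ℕ
  rdegL i []       = 0
  rdegL i (v ∷ vs) = rdegV i v + rdegL i vs

mutual
  fillV : ∀ {k} (r : RigV k) → ((i : Fin k) → Vec (RV 0) (rdegV i r)) → RV 0
  fillV (hole j)  vs = head (subst (Vec (RV 0)) (δ-refl j) (vs j))
  fillV (var x)   vs = var x
  fillV (lam x r) vs = lam x (fillS r vs)

  fillS : ∀ {k} (r : RigS k) → ((i : Fin k) → Vec (RV 0) (rdegS i r)) → RS 0
  fillS (app r₁ r₂) vs =
    app (fillS r₁ (λ i → take (rdegS i r₁) (vs i)))
        (fillS r₂ (λ i → drop (rdegS i r₁) (vs i)))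
  fillS (list rs) vs = bag (fillL rs vs)

  fillL : ∀ {k} (rs : List (RigV k)) → ((i : Fin k) → Vec (RV 0) (rdegL i rs)) →
          List (RV 0)
  fillL []       vs = []
  fillL (r ∷ rs) vs =
    fillV r (λ i → take (rdegV i r) (vs i)) ∷ fillL rs (λ i → drop (rdegV i r) (vs i))

-- A value V has 𝒯(V) = bags of elements of 𝒯ᵥ(V), and holes are filled only with values.
-- So expanding C[V⃗] runs exactly like expanding C, except that each copy of □ᵢ in a bag
-- becomes an element of 𝒯ᵥ(Vᵢ); reading these off in the order of a rigid of the expansion
-- of C gives the fillers. Conversely, filling a rigid of c ∈ 𝒯(C) puts an element of 𝒯ᵥ(Vᵢ)
-- at each □ᵢ, and the permutation hidden in the choice of rigid is absorbed because 𝒯 is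
-- closed under bag equality ≈.
module Submission where

open import Defs
open import Data.Nat using (ℕ; _+_)
open import Data.Nat.ListAction using (sum)
open import Data.Nat.ListAction.Properties using (sum-↭)
open import Data.Fin using (Fin; zero; suc)
open import Data.Vec using (Vec; []; _∷_; _++_; take; drop; head; toList)
open import Data.Vec.Properties using (take++drop≡id; ++-injectiveˡ; ++-injectiveʳ)
open import Data.Vec.Relation.Unary.All as Allᵥ using ([]; _∷_)
open import Data.Vec.Relation.Unary.All.Properties using (take⁺; drop⁺; ++⁺; toList⁺; toList⁻)
open import Data.List using (List; []; _∷_; map; replicate; length)
open import Data.List.Relation.Unary.All as All using (All; []; _∷_)
open import Data.List.Relation.Unary.All.Properties using (replicate⁺; map⁺)
open import Data.List.Relation.Binary.Pointwise using (Pointwise; []; _∷_)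
open import Data.List.Relation.Binary.Permutation.Propositional using (_↭_; ↭-refl; ↭-sym)
open import Data.List.Relation.Binary.Permutation.Propositional.Properties as ↭ using (All-resp-↭)
open import Data.Product using (Σ; ∃-syntax; _×_; _,_)
open import Data.Empty using (⊥)
open import Function.Bundles using (_⇔_; mk⇔)
open import Relation.Binary.PropositionalEquality using (_≡_; refl; subst; sym; trans; cong; cong₂)

module _ {A : Set} where

  take-++ : ∀ {m n} (xs : Vec A m) (ys : Vec A n) → take m (xs ++ ys) ≡ xs
  take-++ {m} xs ys = ++-injectiveˡ (take m (xs ++ ys)) xs (take++drop≡id m (xs ++ ys))

  drop-++ : ∀ {m n} (xs : Vec A m) (ys : Vec A n) → drop m (xs ++ ys) ≡ ys
  drop-++ {m} xs ys = ++-injectiveʳ (take m (xs ++ ys)) xs (take++drop≡id m (xs ++ ys))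

  head-subst⁺ : ∀ {P : A → Set} {n} (eq : n ≡ 1) {xs : Vec A n} →
                Allᵥ.All P xs → P (head (subst (Vec A) eq xs))
  head-subst⁺ refl (p ∷ []) = p

  All-≡⇒replicate : ∀ {a : A} {l} → All (_≡ a) l → l ≡ replicate (length l) a
  All-≡⇒replicate []         = refl
  All-≡⇒replicate (refl ∷ a) = cong (_ ∷_) (All-≡⇒replicate a)

  All-image⇒map : ∀ {B : Set} {P : B → Set} {f : B → A} {l} →
                  All (λ a → ∃[ b ] a ≡ f b × P b) l → ∃[ bs ] l ≡ map f bs × All P bs
  All-image⇒map []                  = [] , refl , []
  All-image⇒map ((b , refl , p) ∷ a) with All-image⇒map a
  ... | bs , refl , ps = b ∷ bs , refl , p ∷ ps

  onlyAt : ∀ {k} (i : Fin k) → A → (j : Fin k) → Vec A (δ j i)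
  onlyAt zero    v zero    = v ∷ []
  onlyAt zero    v (suc j) = []
  onlyAt (suc i) v zero    = []
  onlyAt (suc i) v (suc j) = onlyAt i v j

  onlyAt⁺ : ∀ {k} {P : Fin k → A → Set} (i : Fin k) {v} → P i v →
            ∀ j → Allᵥ.All (P j) (onlyAt i v j)
  onlyAt⁺ zero    p zero    = p ∷ []
  onlyAt⁺ zero    p (suc j) = []
  onlyAt⁺ (suc i) p zero    = []
  onlyAt⁺ {P = P} (suc i) p (suc j) = onlyAt⁺ {P = λ j → P (suc j)} i p j

  head-onlyAt : ∀ {k} (i : Fin k) (v : A) → head (subst (Vec A) (δ-refl i) (onlyAt i v i)) ≡ v
  head-onlyAt zero    v = refl
  head-onlyAt (suc i) v = head-onlyAt i v

-- Holes count as values: they are only ever filled with values.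
data IsValueᶜ {k : ℕ} : Ctx k → Set where
  hole : ∀ i → IsValueᶜ (hole i)
  var  : ∀ x → IsValueᶜ (var x)
  lam  : ∀ x C → IsValueᶜ (lam x C)

isValue⇒isValueᶜ : ∀ {M} → IsValue M → IsValueᶜ M
isValue⇒isValueᶜ (isVar x)   = var x
isValue⇒isValueᶜ (isLam x M) = lam x M

plug-isValueᶜ : ∀ {k} {V : Fin k → Term} → (∀ i → IsValue (V i)) →
                ∀ {C} → IsValueᶜ C → IsValueᶜ (plug C V)
plug-isValueᶜ V-values (hole i)  = isValue⇒isValueᶜ (V-values i)
plug-isValueᶜ V-values (var x)   = var x
plug-isValueᶜ V-values (lam x C) = lam x (plug C _)

-- 𝒯ᵥ(C): the resource values that occur as single elements of the bags in 𝒯(C).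
Taylorᵛ : ∀ {k} → Ctx k → RV k → Set
Taylorᵛ (hole i)  v = v ≡ hole i
Taylorᵛ (var x)   v = v ≡ var x
Taylorᵛ (lam x C) v = ∃[ s ] v ≡ lam x s × Taylor C s
Taylorᵛ (app C D) v = ⊥

taylor-bag⇒isValueᶜ : ∀ {k} {C : Ctx k} {l} → Taylor C (bag l) → IsValueᶜ C
taylor-bag⇒isValueᶜ (t-hole i m)   = hole i
taylor-bag⇒isValueᶜ (t-var x m)    = var x
taylor-bag⇒isValueᶜ (t-lam x ss a) = lam x _

taylor-isValueᶜ⇒bag : ∀ {k} {C : Ctx k} {s} → IsValueᶜ C → Taylor C s → ∃[ l ] s ≡ bag l
taylor-isValueᶜ⇒bag (hole i)  (t-hole i m)   = _ , refl
taylor-isValueᶜ⇒bag (var x)   (t-var x m)    = _ , refl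
taylor-isValueᶜ⇒bag (lam x C) (t-lam x ss a) = _ , refl

taylor-bag⁻ : ∀ {k} {C : Ctx k} {l} → Taylor C (bag l) → All (Taylorᵛ C) l
taylor-bag⁻ (t-hole i m)   = replicate⁺ m refl
taylor-bag⁻ (t-var x m)    = replicate⁺ m refl
taylor-bag⁻ (t-lam x ss a) = map⁺ (All.map (λ t → _ , refl , t) a)

taylor-bag⁺ : ∀ {k} {C : Ctx k} {l} → IsValueᶜ C → All (Taylorᵛ C) l → Taylor C (bag l)
taylor-bag⁺ (hole i) a rewrite All-≡⇒replicate a = t-hole i _
taylor-bag⁺ (var x)  a rewrite All-≡⇒replicate a = t-var x _
taylor-bag⁺ (lam x C) a with All-image⇒map a
... | ss , refl , ts = t-lam x ss ts

mutual
  ≈V-refl : ∀ {k} (v : RV k) → v ≈V v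
  ≈V-refl (hole i)  = hole i
  ≈V-refl (var x)   = var x
  ≈V-refl (lam x s) = lam x (≈S-refl s)

  ≈S-refl : ∀ {k} (s : RS k) → s ≈S s
  ≈S-refl (app s t) = app (≈S-refl s) (≈S-refl t)
  ≈S-refl (bag vs)  = bag vs ↭-refl (≈L-refl vs)

  ≈L-refl : ∀ {k} (vs : List (RV k)) → Pointwise _≈V_ vs vs
  ≈L-refl []       = []
  ≈L-refl (v ∷ vs) = ≈V-refl v ∷ ≈L-refl vs

≈S-reflexive : ∀ {k} {s t : RS k} → s ≡ t → s ≈S t
≈S-reflexive {s = s} refl = ≈S-refl s

mutual
  Taylor-resp-≈ : ∀ {k} {C : Ctx k} {s t} → s ≈S t → Taylor C t → Taylor C s
  Taylor-resp-≈ (app e f)    (t-app a b) = t-app (Taylor-resp-≈ e a) (Taylor-resp-≈ f b)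
  Taylor-resp-≈ (bag vs p q) t           =
    taylor-bag⁺ (taylor-bag⇒isValueᶜ t) (All-resp-↭ (↭-sym p) (Taylorᵛ-resp-≋ q (taylor-bag⁻ t)))

  Taylorᵛ-resp-≋ : ∀ {k} {C : Ctx k} {vs ws} →
                   Pointwise _≈V_ vs ws → All (Taylorᵛ C) ws → All (Taylorᵛ C) vs
  Taylorᵛ-resp-≋ []      []      = []
  Taylorᵛ-resp-≋ (e ∷ q) (t ∷ a) = Taylorᵛ-resp-≈ e t ∷ Taylorᵛ-resp-≋ q a

  Taylorᵛ-resp-≈ : ∀ {k} {C : Ctx k} {v w} → v ≈V w → Taylorᵛ C w → Taylorᵛ C v
  Taylorᵛ-resp-≈                  (hole i)  t              = t
  Taylorᵛ-resp-≈                  (var x)   t              = t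
  Taylorᵛ-resp-≈ {C = lam y C}    (lam x e) (_ , refl , t) = _ , refl , Taylor-resp-≈ e t
  Taylorᵛ-resp-≈ {C = hole i}     (lam x e) ()
  Taylorᵛ-resp-≈ {C = var y}      (lam x e) ()
  Taylorᵛ-resp-≈ {C = app C D}    (lam x e) ()

degL≡sum : ∀ {k} (i : Fin k) (vs : List (RV k)) → degL i vs ≡ sum (map (degV i) vs)
degL≡sum i []       = refl
degL≡sum i (v ∷ vs) = cong (degV i v +_) (degL≡sum i vs)

degL-resp-↭ : ∀ {k} (i : Fin k) {cs cσ} → cs ↭ cσ → degL i cs ≡ degL i cσ
degL-resp-↭ i {cs} {cσ} p =
  trans (degL≡sum i cs) (trans (sum-↭ (↭.map⁺ (degV i) p)) (sym (degL≡sum i cσ)))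

mutual
  rdegV-rigid : ∀ {k} {c : RV k} {r} → RigidV c r → ∀ i → rdegV i r ≡ degV i c
  rdegV-rigid (hole j)  i = refl
  rdegV-rigid (var x)   i = refl
  rdegV-rigid (lam x p) i = rdegS-rigid p i

  rdegS-rigid : ∀ {k} {c : RS k} {r} → RigidS c r → ∀ i → rdegS i r ≡ degS i c
  rdegS-rigid (app p q)         i = cong₂ _+_ (rdegS-rigid p i) (rdegS-rigid q i)
  rdegS-rigid (list cσ perm pw) i = trans (rdegL-rigid pw i) (sym (degL-resp-↭ i perm))

  rdegL-rigid : ∀ {k} {cs : List (RV k)} {rs} → Pointwise RigidV cs rs → ∀ i → rdegL i rs ≡ degL i cs
  rdegL-rigid []       i = refl
  rdegL-rigid (p ∷ pw) i = cong₂ _+_ (rdegV-rigid p i) (rdegL-rigid pw i)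

Fillers : ∀ {k} → (Fin k → ℕ) → Set
Fillers {k} deg = (i : Fin k) → Vec (RV 0) (deg i)

-- Fillers are functions, so filling is only known to respect their pointwise equality.
mutual
  fillV-cong : ∀ {k} (r : RigV k) {vs ws} → (∀ i → vs i ≡ ws i) → fillV r vs ≡ fillV r ws
  fillV-cong (hole j)  e = cong (λ z → head (subst (Vec (RV 0)) (δ-refl j) z)) (e j)
  fillV-cong (var x)   e = refl
  fillV-cong (lam x r) e = cong (lam x) (fillS-cong r e)

  fillS-cong : ∀ {k} (r : RigS k) {vs ws} → (∀ i → vs i ≡ ws i) → fillS r vs ≡ fillS r ws
  fillS-cong (app r₁ r₂) e =
    cong₂ app (fillS-cong r₁ (λ i → cong (take (rdegS i r₁)) (e i)))
              (fillS-cong r₂ (λ i → cong (drop (rdegS i r₁)) (e i)))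
  fillS-cong (list rs)   e = cong bag (fillL-cong rs e)

  fillL-cong : ∀ {k} (rs : List (RigV k)) {vs ws} → (∀ i → vs i ≡ ws i) → fillL rs vs ≡ fillL rs ws
  fillL-cong []       e = refl
  fillL-cong (r ∷ rs) e =
    cong₂ _∷_ (fillV-cong r (λ i → cong (take (rdegV i r)) (e i)))
              (fillL-cong rs (λ i → cong (drop (rdegV i r)) (e i)))

fillS-app-++ : ∀ {k} (r₁ r₂ : RigS k) (vs₁ : Fillers (λ i → rdegS i r₁)) (vs₂ : Fillers (λ i → rdegS i r₂)) →
               fillS (app r₁ r₂) (λ i → vs₁ i ++ vs₂ i) ≡ app (fillS r₁ vs₁) (fillS r₂ vs₂)
fillS-app-++ r₁ r₂ vs₁ vs₂ =
  cong₂ app (fillS-cong r₁ (λ i → take-++ (vs₁ i) (vs₂ i)))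
            (fillS-cong r₂ (λ i → drop-++ (vs₁ i) (vs₂ i)))

fillL-∷-++ : ∀ {k} (r : RigV k) (rs : List (RigV k))
             (vs : Fillers (λ i → rdegV i r)) (ws : Fillers (λ i → rdegL i rs)) →
             fillL (r ∷ rs) (λ i → vs i ++ ws i) ≡ fillV r vs ∷ fillL rs ws
fillL-∷-++ r rs vs ws =
  cong₂ _∷_ (fillV-cong r (λ i → take-++ (vs i) (ws i)))
            (fillL-cong rs (λ i → drop-++ (vs i) (ws i)))

record Filling {k : ℕ} {A R B : Set} (Expands : A → Set) (Rigid : A → R → Set)
               (deg : Fin k → R → ℕ) (fill : (r : R) → Fillers (λ i → deg i r) → B)
               (V : Fin k → Term) (b : B) : Set where
  constructor filling
  field
    {source}        : A
    {rigid}         : R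
    fillers         : Fillers (λ i → deg i rigid)
    source-expands  : Expands source
    rigid-of-source : Rigid source rigid
    fillers-expand  : ∀ i → Allᵥ.All (Taylorᵛ (V i)) (fillers i)
    fills           : b ≡ fill rigid fillers

FillingS : ∀ {k} → Ctx k → (Fin k → Term) → RS 0 → Set
FillingS C = Filling (Taylor C) RigidS rdegS fillS

FillingV : ∀ {k} → Ctx k → (Fin k → Term) → RV 0 → Set
FillingV C = Filling (Taylorᵛ C) RigidV rdegV fillV

FillingL : ∀ {k} → Ctx k → (Fin k → Term) → List (RV 0) → Set
FillingL C = Filling (All (Taylorᵛ C)) (Pointwise RigidV) rdegL fillL

module _ {k : ℕ} {V : Fin k → Term} where

  filling-app : ∀ {C D s t} → FillingS C V s → FillingS D V t → FillingS (app C D) V (app s t)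
  filling-app (filling {rigid = r₁} vs₁ c₁ r̄₁ e₁ refl) (filling {rigid = r₂} vs₂ c₂ r̄₂ e₂ refl) =
    filling (λ i → vs₁ i ++ vs₂ i) (t-app c₁ c₂) (app r̄₁ r̄₂) (λ i → ++⁺ (e₁ i) (e₂ i))
            (sym (fillS-app-++ r₁ r₂ vs₁ vs₂))

  filling-∷ : ∀ {C v l} → FillingV C V v → FillingL C V l → FillingL C V (v ∷ l)
  filling-∷ (filling {rigid = r} vs c r̄ e refl) (filling {rigid = rs} ws cs r̄s es refl) =
    filling (λ i → vs i ++ ws i) (c ∷ cs) (r̄ ∷ r̄s) (λ i → ++⁺ (e i) (es i))
            (sym (fillL-∷-++ r rs vs ws))

  filling-[] : ∀ {C} → FillingL C V []
  filling-[] = filling (λ _ → []) [] [] (λ _ → []) refl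

  filling-lam : ∀ x {C s} → FillingS C V s → FillingV (lam x C) V (lam x s)
  filling-lam x (filling vs c r̄ e refl) = filling vs (_ , refl , c) (lam x r̄) e refl

  filling-bag : ∀ {C l} → IsValueᶜ C → FillingL C V l → FillingS C V (bag l)
  filling-bag iv (filling vs cs r̄s e refl) = filling vs (taylor-bag⁺ iv cs) (list _ ↭-refl r̄s) e refl

module _ {k : ℕ} (V : Fin k → Term) (V-values : ∀ i → IsValue (V i)) where

  mutual
    decompose : (C : Ctx k) {s : RS 0} → Taylor (plug C V) s → FillingS C V s
    decompose (hole i)  t           = decompose-bag (hole i) t
    decompose (var x)   t           = decompose-bag (var x) t
    decompose (lam x C) t           = decompose-bag (lam x C) t
    decompose (app C D) (t-app a b) = filling-app (decompose C a) (decompose D b)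

    decompose-bag : {C : Ctx k} (iv : IsValueᶜ C) {s : RS 0} → Taylor (plug C V) s → FillingS C V s
    decompose-bag {C} iv t with taylor-isValueᶜ⇒bag (plug-isValueᶜ V-values iv) t
    ... | _ , refl = filling-bag iv (decomposeL C (taylor-bag⁻ t))

    decomposeL : (C : Ctx k) {l : List (RV 0)} → All (Taylorᵛ (plug C V)) l → FillingL C V l
    decomposeL C []       = filling-[]
    decomposeL C (t ∷ ts) = filling-∷ (decomposeᵛ C t) (decomposeL C ts)

    decomposeᵛ : (C : Ctx k) {v : RV 0} → Taylorᵛ (plug C V) v → FillingV C V v
    decomposeᵛ (hole i)  {v} t          =
      filling (onlyAt i v) refl (hole i) (onlyAt⁺ i t) (sym (head-onlyAt i v))
    decomposeᵛ (var x)   refl           = filling (λ _ → []) refl (var x) (λ _ → []) refl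
    decomposeᵛ (lam x C) (_ , refl , t) = filling-lam x (decompose C t)

  mutual
    taylor-fillS : ∀ {C c r} → Taylor C c → RigidS c r →
                   ∀ {vs} → (∀ i → Allᵥ.All (Taylorᵛ (V i)) (vs i)) → Taylor (plug C V) (fillS r vs)
    taylor-fillS (t-app a b) (app {r₁ = r₁} p q) e =
      t-app (taylor-fillS a p (λ i → take⁺ (rdegS i r₁) (e i)))
            (taylor-fillS b q (λ i → drop⁺ (rdegS i r₁) (e i)))
    taylor-fillS t (list cσ perm pw) e =
      taylor-bag⁺ (plug-isValueᶜ V-values (taylor-bag⇒isValueᶜ t))
                  (taylorᵛ-fillL (All-resp-↭ perm (taylor-bag⁻ t)) pw e)

    taylorᵛ-fillL : ∀ {C cs rs} → All (Taylorᵛ C) cs → Pointwise RigidV cs rs →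
                    ∀ {vs} → (∀ i → Allᵥ.All (Taylorᵛ (V i)) (vs i)) → All (Taylorᵛ (plug C V)) (fillL rs vs)
    taylorᵛ-fillL []       []                 e = []
    taylorᵛ-fillL (t ∷ ts) (_∷_ {y = r} p pw) e =
      taylorᵛ-fillV t p (λ i → take⁺ (rdegV i r) (e i)) ∷ taylorᵛ-fillL ts pw (λ i → drop⁺ (rdegV i r) (e i))

    taylorᵛ-fillV : ∀ {C c r} → Taylorᵛ C c → RigidV c r →
                    ∀ {vs} → (∀ i → Allᵥ.All (Taylorᵛ (V i)) (vs i)) → Taylorᵛ (plug C V) (fillV r vs)
    taylorᵛ-fillV {hole i}  refl           (hole i)  e = head-subst⁺ (δ-refl i) (e i)
    taylorᵛ-fillV {var x}   refl           (var x)   e = refl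
    taylorᵛ-fillV {lam x C} (_ , refl , t) (lam x p) e = _ , refl , taylor-fillS t p e

mainTheorem4 : ∀ {k : ℕ} (C : Ctx k) (V : Fin k → Term) →
    (∀ i → IsValue (V i)) →
    (s : RS 0) →
    Taylor (plug C V) s ⇔
      Σ (RS k) λ c → Σ (RigS k) λ r →
        Σ ((i : Fin k) → Vec (RV 0) (rdegS i r)) λ vs →
          Taylor C c × RigidS c r ×
          (∀ i → rdegS i r ≡ degS i c) ×
          (∀ i → Taylor (V i) (bag (toList (vs i)))) ×
          s ≈S fillS r vs
mainTheorem4 C V V-values s = mk⇔
  (λ t → let open Filling (decompose V V-values C t) in
    source , rigid , fillers , source-expands , rigid-of-source , rdegS-rigid rigid-of-source ,
    (λ i → taylor-bag⁺ (isValue⇒isValueᶜ (V-values i)) (toList⁺ (fillers-expand i))) ,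
    ≈S-reflexive fills)
  (λ (_ , _ , vs , c-expands , rigid , _ , vs-expand , s≈fill) →
    Taylor-resp-≈ s≈fill
      (taylor-fillS V V-values c-expands rigid (λ i → toList⁻ (taylor-bag⁻ (vs-expand i)))))
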